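{- Let $\Gamma$ be an $\mathbf{FO}^2$ sentence (without equality) in Scott normal form, with 1-types $\tau_1,\dots,\tau_{|U|}$. For any configuration $\mathbf{n}$ of $\Gamma$, if $\mathbf{n}$ is satisfiable, then every configuration $\mathbf{n}'$ of $\Gamma$ with $\mathbf{n}\preccurlyeq\mathbf{n}'$ is also satisfiable.
   Context: $\Gamma$ is a function-free sentence of the form $\forall x\forall y\,\phi(x,y)\land\bigwedge_{k=1}^m\forall x\exists y\,\beta_k(x,y)$, where $\phi$ is quantifier-free and the $\beta_k$ are binary predicates; structures have finite domains. A 1-type of $\Gamma$ is a maximally consistent set of literals over the predicates of $\Gamma$ in which every literal involves only the single variable $x$ (e.g. $P(x)$, $E(x,x)$); $U=\{\tau_1,\dots,\tau_{|U|}\}$ is the set of all 1-types. In a structure, an element $e$ realizes $\tau$ if $\tau(e)$ holds; every element realizes exactly one 1-type. A configuration is a vector $\mathbf{n}=(n_1,\dots,n_{|U|})$ of non-negative integers; it is satisfiable if there is a model of $\Gamma$ over a domain of size $n_1+\dots+n_{|U|}$ in which exactly $n_i$ elements realize $\tau_i$ for each $i$. For configurations $\mathbf{n},\mathbf{n}'$, write $\mathbf{n}\preccurlyeq\mathbf{n}'$ if for all $i$: $n_i'\ge n_i$ when $n_i>0$, and $n_i'=n_i$ when $n_i=0$. -}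

module Defs where

open import Data.Nat using (ℕ; _≤_; _>_)
open import Data.Bool using (Bool; true; false; not; _∧_; _∨_)
open import Data.Fin using (Fin)
open import Data.Vec using (Vec; tabulate)
open import Data.List using (List; filter; length)
open import Data.List using () renaming (allFin to allFinL)
open import Data.Product using (Σ; _×_; _,_; ∃)
open import Relation.Binary.PropositionalEquality using (_≡_)
open import Relation.Nullary using (Dec)
open import Data.Vec.Properties using (≡-dec)
open import Data.Bool.Properties using () renaming (_≟_ to _≟B_)
open import Data.Product.Properties using () renaming (≡-dec to ×-≡-dec)

-- A relational vocabulary (without equality, without function symbols):
-- u unary predicate symbols and b binary predicate symbols.

data Var : Set where
  vx vy : Var

data QF (u b : ℕ) : Set where
  tt    : QF u b
  uatom : Fin u → Var → QF u b
  batom : Fin b → Var → Var → QF u b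
  ¬'_   : QF u b → QF u b
  _∧'_  : QF u b → QF u b → QF u b
  _∨'_  : QF u b → QF u b → QF u b

-- Sentence in Scott normal form:
--   ∀x∀y φ(x,y) ∧ ⋀_{k=1}^m ∀x∃y β_k(x,y),  β_k binary predicate symbols.
record Scott (u b : ℕ) : Set where
  field
    φ : QF u b
    m : ℕ
    β : Fin m → Fin b

record Structure (u b N : ℕ) : Set where
  field
    U : Fin u → Fin N → Bool
    B : Fin b → Fin N → Fin N → Bool

module _ {u b N : ℕ} (𝔄 : Structure u b N) where
  open Structure 𝔄

  evalQF : QF u b → Fin N → Fin N → Bool
  evalQF tt          a c = true
  evalQF (uatom P v) a c = U P (val v) where
    val : Var → Fin N
    val vx = a
    val vy = c
  evalQF (batom R v w) a c = B R (val v) (val w) where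
    val : Var → Fin N
    val vx = a
    val vy = c
  evalQF (¬' f)   a c = not (evalQF f a c)
  evalQF (f ∧' g) a c = evalQF f a c ∧ evalQF g a c
  evalQF (f ∨' g) a c = evalQF f a c ∨ evalQF g a c

  Models : Scott u b → Set
  Models Γ = (∀ a c → evalQF (Scott.φ Γ) a c ≡ true)
           × (∀ k a → ∃ λ c → B (Scott.β Γ k) a c ≡ true)

-- A 1-type: a maximally consistent set of one-variable literals, i.e. a choice
-- of polarity for every atom P(x) (P unary) and R(x,x) (R binary).
OneType : ℕ → ℕ → Set
OneType u b = Vec Bool u × Vec Bool b

_≟τ_ : ∀ {u b} (τ σ : OneType u b) → Dec (τ ≡ σ)
_≟τ_ = ×-≡-dec (≡-dec _≟B_) (≡-dec _≟B_)

tp : ∀ {u b N} → Structure u b N → Fin N → OneType u b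
tp 𝔄 e = tabulate (λ P → Structure.U 𝔄 P e) , tabulate (λ R → Structure.B 𝔄 R e e)

count : ∀ {u b N} → Structure u b N → OneType u b → ℕ
count {N = N} 𝔄 τ = length (filter (λ e → tp 𝔄 e ≟τ τ) (allFinL N))

Config : ℕ → ℕ → Set
Config u b = OneType u b → ℕ

-- n is satisfiable (for Γ): some finite model realizes each τ exactly n_τ times
-- (its domain size is then necessarily Σ_τ n_τ).
Satisfiable : ∀ {u b} → Scott u b → Config u b → Set
Satisfiable {u} {b} Γ n =
  Σ ℕ λ N → Σ (Structure u b N) λ 𝔄 → Models 𝔄 Γ × (∀ τ → count 𝔄 τ ≡ n τ)

_≼_ : ∀ {u b} → Config u b → Config u b → Set
n ≼ n' = ∀ τ → (n τ > 0 → n τ ≤ n' τ) × (n τ ≡ 0 → n' τ ≡ 0)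

-- Without equality, a structure can be enlarged by duplicating elements: pull
-- it back along a surjection f from a bigger domain. Atoms, hence all
-- quantifier-free formulas, are evaluated at the images under f, so
-- ∀x∀y φ survives; surjectivity transports the witnesses of ∀x∃y β_k; and a
-- copy of e realizes the same 1-type as e. For every 1-type τ with n_τ > 0
-- we therefore add n'_τ − n_τ copies of one element of type τ. Types with
-- n_τ = 0 have nothing to copy, which is why ≼ requires n'_τ = 0 for them.
module Submission where

open import Defs
open import Data.Nat using (ℕ; suc; _+_; _∸_; _≤_; _>_) renaming (_≟_ to _≟ℕ_)
open import Data.Nat.Properties using (+-identityʳ; m+[n∸m]≡n; n≢0⇒n>0)
open import Data.Bool using (true; not; _∧_; _∨_)
open import Data.Fin using (Fin)
open import Data.List
  using (List; []; _∷_; _++_; filter; length; replicate; map; lookup)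
  renaming (allFin to allFinL)
open import Data.List.Properties
  using (length-++; filter-++; filter-all; filter-none; length-replicate; tabulate-lookup; map-tabulate)
open import Data.List.Relation.Unary.All.Properties using (replicate⁺)
open import Data.List.Relation.Unary.Any using (index)
open import Data.List.Relation.Unary.Any.Properties using (lookup-index)
open import Data.List.Membership.Propositional using (_∈_)
open import Data.List.Membership.Propositional.Properties using (∈-allFin; ∈-++⁺ˡ)
open import Data.Product using (Σ; _×_; _,_)
open import Function.Definitions using (StrictlySurjective)
open import Relation.Binary.Definitions using (DecidableEquality)
open import Relation.Binary.PropositionalEquality
open import Relation.Nullary using (yes; no; ¬_; contradiction)
open ≡-Reasoning

pullback : ∀ {u b M N} → Structure u b N → (Fin M → Fin N) → Structure u b M
pullback 𝔄 f = record
  { U = λ P a → Structure.U 𝔄 P (f a)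
  ; B = λ R a c → Structure.B 𝔄 R (f a) (f c)
  }

module _ {u b M N} (𝔄 : Structure u b N) (f : Fin M → Fin N) where

  evalQF-pullback : ∀ φ a c → evalQF (pullback 𝔄 f) φ a c ≡ evalQF 𝔄 φ (f a) (f c)
  evalQF-pullback tt              a c = refl
  evalQF-pullback (uatom P vx)    a c = refl
  evalQF-pullback (uatom P vy)    a c = refl
  evalQF-pullback (batom R vx vx) a c = refl
  evalQF-pullback (batom R vx vy) a c = refl
  evalQF-pullback (batom R vy vx) a c = refl
  evalQF-pullback (batom R vy vy) a c = refl
  evalQF-pullback (¬' φ)          a c = cong not (evalQF-pullback φ a c)
  evalQF-pullback (φ ∧' ψ)        a c = cong₂ _∧_ (evalQF-pullback φ a c) (evalQF-pullback ψ a c)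
  evalQF-pullback (φ ∨' ψ)        a c = cong₂ _∨_ (evalQF-pullback φ a c) (evalQF-pullback ψ a c)

  Models-pullback : StrictlySurjective _≡_ f →
                    ∀ Γ → Models 𝔄 Γ → Models (pullback 𝔄 f) Γ
  Models-pullback surj Γ (⊨φ , ⊨β) = ⊨φ′ , ⊨β′
    where
    open Scott Γ
    ⊨φ′ : ∀ a c → evalQF (pullback 𝔄 f) φ a c ≡ true
    ⊨φ′ a c = trans (evalQF-pullback φ a c) (⊨φ (f a) (f c))
    ⊨β′ : ∀ k a → Σ (Fin M) λ c → Structure.B 𝔄 (β k) (f a) (f c) ≡ true
    ⊨β′ k a with ⊨β k (f a)
    ... | c , Bac with surj c
    ...   | c′ , refl = c′ , Bac

lookup-strictlySurjective : ∀ {A : Set} (xs : List A) →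
                            (∀ y → y ∈ xs) → StrictlySurjective _≡_ (lookup xs)
lookup-strictlySurjective xs complete y =
  index (complete y) , sym (lookup-index (complete y))

module Counting {C : Set} (_≟_ : DecidableEquality C) {X : Set} (g : X → C) where

  countBy : C → List X → ℕ
  countBy c xs = length (filter (λ x → g x ≟ c) xs)

  countBy-++ : ∀ c xs ys → countBy c (xs ++ ys) ≡ countBy c xs + countBy c ys
  countBy-++ c xs ys = begin
    length (filter (λ x → g x ≟ c) (xs ++ ys))
      ≡⟨ cong length (filter-++ (λ x → g x ≟ c) xs ys) ⟩
    length (filter (λ x → g x ≟ c) xs ++ filter (λ x → g x ≟ c) ys)
      ≡⟨ length-++ (filter (λ x → g x ≟ c) xs) ⟩
    countBy c xs + countBy c ys ∎

  countBy-replicate-≡ : ∀ {c x} k → g x ≡ c → countBy c (replicate k x) ≡ k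
  countBy-replicate-≡ {c} k gx≡c = begin
    length (filter (λ x → g x ≟ c) (replicate k _))
      ≡⟨ cong length (filter-all (λ x → g x ≟ c) (replicate⁺ k gx≡c)) ⟩
    length (replicate k _)
      ≡⟨ length-replicate k ⟩
    k ∎

  countBy-replicate-≢ : ∀ {c x} k → ¬ g x ≡ c → countBy c (replicate k x) ≡ 0
  countBy-replicate-≢ {c} k gx≢c =
    cong length (filter-none (λ x → g x ≟ c) (replicate⁺ k gx≢c))

  zeroAt : C → (C → ℕ) → C → ℕ
  zeroAt c d c′ with c ≟ c′
  ... | yes _ = 0
  ... | no  _ = d c′

  zeroAt-self : ∀ {c c′} d → c ≡ c′ → zeroAt c d c′ ≡ 0
  zeroAt-self {c} {c′} d c≡c′ with c ≟ c′
  ... | yes _    = refl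
  ... | no c≢c′ = contradiction c≡c′ c≢c′

  zeroAt-other : ∀ {c c′} d → ¬ c ≡ c′ → zeroAt c d c′ ≡ d c′
  zeroAt-other {c} {c′} d c≢c′ with c ≟ c′
  ... | yes c≡c′ = contradiction c≡c′ c≢c′
  ... | no _     = refl

  -- d (g x) copies of x are added at the first occurrence of each colour g x;
  -- zeroing d there keeps later elements of the same colour from adding more.
  padding : (C → ℕ) → List X → List X
  padding d []       = []
  padding d (x ∷ xs) = replicate (d (g x)) x ++ padding (zeroAt (g x) d) xs

  countBy-padding-vanishing : ∀ {c} d xs → d c ≡ 0 → countBy c (padding d xs) ≡ 0
  countBy-padding-vanishing     d []       _    = refl
  countBy-padding-vanishing {c} d (x ∷ xs) dc≡0 with g x ≟ c
  ... | yes gx≡c = trans (countBy-++ c (replicate (d (g x)) x) _) (cong₂ _+_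
        (trans (countBy-replicate-≡ (d (g x)) gx≡c) (trans (cong d gx≡c) dc≡0))
        (countBy-padding-vanishing _ xs (zeroAt-self d gx≡c)))
  ... | no  gx≢c = trans (countBy-++ c (replicate (d (g x)) x) _) (cong₂ _+_
        (countBy-replicate-≢ (d (g x)) gx≢c)
        (countBy-padding-vanishing _ xs (trans (zeroAt-other d gx≢c) dc≡0)))

  countBy-padding-absent : ∀ {c} d xs → countBy c xs ≡ 0 → countBy c (padding d xs) ≡ 0
  countBy-padding-absent     d []       _    = refl
  countBy-padding-absent {c} d (x ∷ xs) none with g x ≟ c
  ... | no gx≢c = trans (countBy-++ c (replicate (d (g x)) x) _) (cong₂ _+_
        (countBy-replicate-≢ (d (g x)) gx≢c)
        (countBy-padding-absent _ xs none))

  countBy-padding-present : ∀ {c} d xs → countBy c xs > 0 → countBy c (padding d xs) ≡ d c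
  countBy-padding-present     d []       ()
  countBy-padding-present {c} d (x ∷ xs) some with g x ≟ c
  ... | yes gx≡c = begin
    countBy c (replicate (d (g x)) x ++ padding (zeroAt (g x) d) xs)
      ≡⟨ countBy-++ c (replicate (d (g x)) x) _ ⟩
    countBy c (replicate (d (g x)) x) + countBy c (padding (zeroAt (g x) d) xs)
      ≡⟨ cong₂ _+_ (countBy-replicate-≡ (d (g x)) gx≡c)
                   (countBy-padding-vanishing _ xs (zeroAt-self d gx≡c)) ⟩
    d (g x) + 0
      ≡⟨ +-identityʳ _ ⟩
    d (g x)
      ≡⟨ cong d gx≡c ⟩
    d c ∎
  ... | no  gx≢c = begin
    countBy c (replicate (d (g x)) x ++ padding (zeroAt (g x) d) xs)
      ≡⟨ countBy-++ c (replicate (d (g x)) x) _ ⟩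
    countBy c (replicate (d (g x)) x) + countBy c (padding (zeroAt (g x) d) xs)
      ≡⟨ cong₂ _+_ (countBy-replicate-≢ (d (g x)) gx≢c) (countBy-padding-present _ xs some) ⟩
    zeroAt (g x) d c
      ≡⟨ zeroAt-other d gx≢c ⟩
    d c ∎

  deficit : (C → ℕ) → List X → C → ℕ
  deficit t xs c = t c ∸ countBy c xs

  padTo : (C → ℕ) → List X → List X
  padTo t xs = xs ++ padding (deficit t xs) xs

  countBy-padTo : ∀ t xs c →
                  (countBy c xs > 0 → countBy c xs ≤ t c) × (countBy c xs ≡ 0 → t c ≡ 0) →
                  countBy c (padTo t xs) ≡ t c
  countBy-padTo t xs c (≤t , none⇒0) with countBy c xs ≟ℕ 0
  ... | yes none = begin
    countBy c (padTo t xs)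
      ≡⟨ countBy-++ c xs _ ⟩
    countBy c xs + countBy c (padding (deficit t xs) xs)
      ≡⟨ cong₂ _+_ none (countBy-padding-absent (deficit t xs) xs none) ⟩
    0
      ≡⟨ sym (none⇒0 none) ⟩
    t c ∎
  ... | no  some≢0 = begin
    countBy c (padTo t xs)
      ≡⟨ countBy-++ c xs _ ⟩
    countBy c xs + countBy c (padding (deficit t xs) xs)
      ≡⟨ cong (countBy c xs +_) (countBy-padding-present (deficit t xs) xs (n≢0⇒n>0 some≢0)) ⟩
    countBy c xs + (t c ∸ countBy c xs)
      ≡⟨ m+[n∸m]≡n (≤t (n≢0⇒n>0 some≢0)) ⟩
    t c ∎

open Counting using (countBy)

countBy-map : ∀ {C X Y : Set} (_≟_ : DecidableEquality C) (g : X → C) (f : Y → X) c ys →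
              countBy _≟_ (λ y → g (f y)) c ys ≡ countBy _≟_ g c (map f ys)
countBy-map _≟_ g f c []       = refl
countBy-map _≟_ g f c (y ∷ ys) with g (f y) ≟ c
... | yes _ = cong suc (countBy-map _≟_ g f c ys)
... | no  _ = countBy-map _≟_ g f c ys

count-pullback-lookup : ∀ {u b N} (𝔄 : Structure u b N) (L : List (Fin N)) τ →
                        count (pullback 𝔄 (lookup L)) τ ≡ countBy _≟τ_ (tp 𝔄) τ L
count-pullback-lookup 𝔄 L τ = begin
  count (pullback 𝔄 (lookup L)) τ
    ≡⟨ countBy-map _≟τ_ (tp 𝔄) (lookup L) τ (allFinL (length L)) ⟩
  countBy _≟τ_ (tp 𝔄) τ (map (lookup L) (allFinL (length L)))
    ≡⟨ cong (countBy _≟τ_ (tp 𝔄) τ) (trans (map-tabulate (λ i → i) (lookup L)) (tabulate-lookup L)) ⟩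
  countBy _≟τ_ (tp 𝔄) τ L ∎

proposition1 : ∀ {u b} (Γ : Scott u b) (n n' : Config u b) →
    Satisfiable Γ n → n ≼ n' → Satisfiable Γ n'
proposition1 Γ n n' (N , 𝔄 , 𝔄⊨Γ , count≡n) n≼n' =
  length L , pullback 𝔄 (lookup L) ,
  Models-pullback 𝔄 (lookup L) (lookup-strictlySurjective L covers) Γ 𝔄⊨Γ , count≡n'
  where
  open Counting _≟τ_ (tp 𝔄) using (padTo; countBy-padTo)
  L : List (Fin N)
  L = padTo n' (allFinL N)

  covers : ∀ e → e ∈ L
  covers e = ∈-++⁺ˡ (∈-allFin e)

  count≡n' : ∀ τ → count (pullback 𝔄 (lookup L)) τ ≡ n' τ
  count≡n' τ = trans (count-pullback-lookup 𝔄 L τ) (countBy-padTo n' (allFinL N) τ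
    (subst (λ k → (k > 0 → k ≤ n' τ) × (k ≡ 0 → n' τ ≡ 0)) (sym (count≡n τ)) (n≼n' τ)))
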